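{- Let $s\ge0$, $1\le h\le m$ and $\ell\ge0$ be integers. The number of compositions $(a_1,\dots,a_h)$ of $m$ into $h$ positive parts having exactly $\ell$ parts $a_i\ge s+2$ (equivalently, whose deletion of the first $s+1$ columns has dimension $\ell$) equals $c^{(s)m}_{h\ell}$, where: for $\ell\ge1$, $$c^{(s)m}_{h\ell}=\sum\frac{\ell}{R}\binom{h}{f_1}\binom{f_1}{f_2}\cdots\binom{f_{s-1}}{f_s}\binom{f_s}{\ell}\binom{R}{\ell},\qquad R=m-h-f_1-\cdots-f_s,$$ the sum over integers $h\ge f_1\ge f_2\ge\cdots\ge f_s\ge\ell$ with $R\ge\ell$ (equivalently $=\binom{h}{\ell}\sum\binom{h-f_2}{f_1-f_2}\cdots\binom{h-f_s}{f_{s-1}-f_s}\binom{h-\ell}{f_s-\ell}\binom{R-1}{\ell-1}$ over the same range); and $$c^{(s)m}_{h0}=\sum\binom{h}{f_1}\binom{f_1}{f_2}\cdots\binom{f_{s-1}}{f_s},$$ the sum over integers $h\ge f_1\ge\cdots\ge f_s\ge0$ with $f_1+\cdots+f_s=m-h$ (this is $0$ if $m>(s+1)h$). For $s=0$ there are no $f$'s: $c^{(0)m}_{h\ell}=\frac{\ell}{m-h}\binom h\ell\binom{m-h}\ell$ for $\ell\ge1$, $h<m$, and $c^{(0)m}_{h0}=1$ if $h=m$, $0$ otherwise.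
   Context: A composition of weight $m$ and dimension $h$ is an ordered $h$-tuple of positive integers summing to $m$. Deleting the first $s+1$ columns of $(a_1,\dots,a_h)$ yields $(a_i-s-1)_{i:\,a_i\ge s+2}$, whose dimension is the number of $i$ with $a_i\ge s+2$. Binomial coefficients $\binom{a}{b}$ are $0$ unless $0\le b\le a$. -}

module Defs where

open import Data.Nat using (ℕ; zero; suc; _+_; _*_; _∸_; _≤_; _≤?_; _≟_)
open import Data.Nat.Combinatorics using (_C_)
open import Data.List using (List; map; applyUpTo)
open import Data.Nat.ListAction using (sum)
open import Data.Vec using (Vec; count)
import Data.Vec as Vec
open import Data.Vec.Relation.Unary.All using (All)
open import Data.Product using (Σ; _×_)
open import Relation.Nullary using (yes; no)

ΣFromTo : ℕ → ℕ → (ℕ → ℕ) → ℕ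
ΣFromTo lo hi g = sum (map g (applyUpTo (lo +_) (suc hi ∸ lo)))

-- Sum over chains  prev ≥ f₁ ≥ f₂ ≥ ... ≥ f_k ≥ lo  of
--   C(prev,f₁) C(f₁,f₂) ... C(f_{k-1},f_k) * fin f_k (acc + f₁ + ... + f_k)
-- (for k = 0 the chain is empty and the value is  fin prev acc).
chainSum : (lo : ℕ) → (fin : ℕ → ℕ → ℕ) → (k prev acc : ℕ) → ℕ
chainSum lo fin zero    prev acc = fin prev acc
chainSum lo fin (suc k) prev acc =
  ΣFromTo lo prev (λ f → (prev C f) * chainSum lo fin k f (acc + f))

-- [ ℓ ≤ R ] * C(R-1, ℓ-1)  (this equals (ℓ/R) C(R,ℓ) when 1 ≤ ℓ ≤ R, and the
-- summation range requires R ≥ ℓ)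
tailFactor : (ℓ R : ℕ) → ℕ
tailFactor ℓ R with ℓ ≤? R
... | yes _ = (R ∸ 1) C (ℓ ∸ 1)
... | no  _ = 0

δ : ℕ → ℕ → ℕ
δ a b with a ≟ b
... | yes _ = 1
... | no  _ = 0

c : (s m h ℓ : ℕ) → ℕ
c s m h zero        = chainSum 0 (λ _ acc → δ acc (m ∸ h)) s h 0
c s m h ℓ@(suc _)   =
  chainSum ℓ (λ last acc → (last C ℓ) * tailFactor ℓ (m ∸ h ∸ acc)) s h 0

IsComposition : (m h : ℕ) → Vec ℕ h → Set
IsComposition m h a = All (1 ≤_) a × Vec.sum a ≡' m
  where
  open import Relation.Binary.PropositionalEquality renaming (_≡_ to _≡'_)

bigParts : (s : ℕ) {h : ℕ} → Vec ℕ h → ℕ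
bigParts s a = count (suc (suc s) ≤?_) a

-- Lowering every part by one turns a composition into a vector of length h,
-- of weight m - h, with ℓ entries ≥ s + 1.  Such a vector b is determined by
-- its support (a subset of size f₁ of the h positions) together with the
-- vector of length f₁ obtained by lowering the entries of b on its support;
-- that vector has weight m - h - f₁ and ℓ entries ≥ s.  Iterating s times
-- produces the chain h ≥ f₁ ≥ ⋯ ≥ f_s and the product of binomials
-- C(h,f₁)⋯C(f_{s-1},f_s).  One more splitting leaves a vector of length f_s
-- whose positive entries are exactly ℓ in number: choose them (C(f_s,ℓ)) and
-- distribute the remaining weight R = m - h - f₁ - ⋯ - f_s over them as a
-- composition of R into ℓ parts (C(R-1,ℓ-1) by stars and bars).  For ℓ = 0
-- that last vector is empty, so the weight must already be exhausted.
module Submission where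

open import Defs
open import Data.Nat using (ℕ; suc; _≤_)
open import Data.Fin using (Fin)
open import Data.Vec using (Vec)
open import Data.Product using (Σ; _×_)
open import Function.Bundles using (_↔_)
open import Relation.Binary.PropositionalEquality using (_≡_)

open import Data.Nat using (zero; _+_; _*_; _∸_; _<_; z≤n; s≤s; _≤?_; _≟_; pred)
open import Data.Nat.Properties
open import Data.Nat.Combinatorics using (_C_; nCk+nC[k+1]≡[n+1]C[k+1]; nCn≡1)
open import Data.Nat.ListAction using (sum)
open import Data.List using (map; applyUpTo; _∷_)
open import Data.Bool using (Bool; true; false)
open import Data.Vec using ([]; _∷_; count; replicate)
import Data.Vec as Vec
open import Data.Vec.Properties using (count≤n; map-∘; map-id)
open import Data.Vec.Relation.Unary.All using (All; []; _∷_)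
import Data.Vec.Relation.Unary.All as All
open import Data.Product using (_,_; proj₁; proj₂)
open import Data.Product.Function.Dependent.Propositional using (Σ-↔)
open import Data.Product.Function.NonDependent.Propositional using (_×-↔_)
open import Data.Product.Properties using (Σ-≡,≡→≡)
open import Data.Sum using (_⊎_; inj₁; inj₂)
open import Data.Sum.Function.Propositional using (_⊎-↔_)
open import Data.Empty using (⊥-elim)
import Data.Fin as Fin
open import Data.Fin.Properties using (+↔⊎; *↔×)
open import Function.Bundles using (mk↔ₛ′)
open import Function.Properties.Inverse using (↔-refl; ↔-sym; ↔-trans)
open import Function.Related.Propositional using (module EquationalReasoning)
open import Function.Related.TypeIsomorphisms using (Σ-assoc)
open import Relation.Nullary using (¬_; Irrelevant; yes; no; does)
open import Relation.Binary.PropositionalEquality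
  using (refl; sym; trans; cong; cong₂; subst)

infixr 5 _⟫_
_⟫_ : {A B C : Set} → A ↔ B → B ↔ C → A ↔ C
_⟫_ = ↔-trans

irrelevant-↔ : {A B : Set} → Irrelevant A → Irrelevant B → (A → B) → (B → A) → A ↔ B
irrelevant-↔ irrA irrB to from = mk↔ₛ′ to from (λ _ → irrB _ _) (λ _ → irrA _ _)

×-irrelevant : {A B : Set} → Irrelevant A → Irrelevant B → Irrelevant (A × B)
×-irrelevant irrA irrB (a , b) (a′ , b′) = cong₂ _,_ (irrA a a′) (irrB b b′)

Fin0↔ : {A : Set} → ¬ A → Fin 0 ↔ A
Fin0↔ ¬a = mk↔ₛ′ (λ ()) (λ a → ⊥-elim (¬a a)) (λ a → ⊥-elim (¬a a)) (λ ())

Fin1↔ : {A : Set} (a : A) → (∀ x → x ≡ a) → Fin 1 ↔ A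
Fin1↔ a unique = mk↔ₛ′ (λ _ → a) (λ _ → Fin.zero) (λ x → sym (unique x))
  λ { Fin.zero → refl ; (Fin.suc ()) }

≡⇒↔ : {A B : Set} → A ≡ B → A ↔ B
≡⇒↔ refl = ↔-refl

Fin-cong : {m n : ℕ} → m ≡ n → Fin m ↔ Fin n
Fin-cong e = ≡⇒↔ (cong Fin e)

Σ-fibres : {A : Set} (X : ℕ → Set) (g : A → ℕ) →
           Σ A (λ a → X (g a)) ↔ Σ ℕ (λ f → Σ A (λ a → g a ≡ f) × X f)
Σ-fibres X g = mk↔ₛ′ (λ (a , x) → g a , (a , refl) , x)
                     (λ (f , (a , e) , x) → a , subst X (sym e) x)
                     (λ { (f , (a , refl) , x) → refl }) (λ _ → refl)

Σ-add-implied : {X R : ℕ → Set} → (∀ {f} → Irrelevant (R f)) → (∀ f → X f → R f) →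
                Σ ℕ X ↔ Σ ℕ (λ f → R f × X f)
Σ-add-implied irrR implied = mk↔ₛ′ (λ (f , x) → f , implied f x , x) (λ (f , _ , x) → f , x)
  (λ (f , r , x) → cong (λ r → f , r , x) (irrR _ _)) (λ _ → refl)

Σ-at : {X Y : ℕ → Set} (k : ℕ) → Σ ℕ (λ f → X f × (f ≡ k × Y f)) ↔ (X k × Y k)
Σ-at k = mk↔ₛ′ (λ { (f , x , refl , y) → x , y }) (λ (x , y) → k , x , refl , y)
               (λ _ → refl) (λ { (f , x , refl , y) → refl })

InRange : ℕ → ℕ → ℕ → Set
InRange lo n f = lo ≤ f × f < lo + n

InRange-irrelevant : ∀ {lo n f} → Irrelevant (InRange lo n f)
InRange-irrelevant = ×-irrelevant ≤-irrelevant ≤-irrelevant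

ΣInRange : ℕ → ℕ → (ℕ → Set) → Set
ΣInRange lo n X = Σ ℕ (λ f → InRange lo n f × X f)

Σ-InRange-suc : (X : ℕ → Set) (lo n : ℕ) →
  (X lo ⊎ ΣInRange (suc lo) n X) ↔ ΣInRange lo (suc n) X
Σ-InRange-suc X lo n = mk↔ₛ′ to from to-from from-to
  where
  to : X lo ⊎ ΣInRange (suc lo) n X → ΣInRange lo (suc n) X
  to (inj₁ x) = lo , (≤-refl , subst (lo <_) (sym (+-suc lo n)) (s≤s (m≤m+n lo n))) , x
  to (inj₂ (f , (lo<f , f<) , x)) = f , (<⇒≤ lo<f , subst (f <_) (sym (+-suc lo n)) f<) , x

  from : ΣInRange lo (suc n) X → X lo ⊎ ΣInRange (suc lo) n X
  from (f , (lo≤f , f<) , x) with m≤n⇒m<n∨m≡n lo≤f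
  ... | inj₁ lo<f = inj₂ (f , (lo<f , subst (f <_) (+-suc lo n) f<) , x)
  ... | inj₂ refl = inj₁ x

  to-from : ∀ y → to (from y) ≡ y
  to-from (f , (lo≤f , _) , x) with m≤n⇒m<n∨m≡n lo≤f
  ... | inj₁ _    = cong (λ r → f , r , x) (InRange-irrelevant _ _)
  ... | inj₂ refl = cong (λ r → f , r , x) (InRange-irrelevant _ _)

  from-to : ∀ x → from (to x) ≡ x
  from-to (inj₁ x) with m≤n⇒m<n∨m≡n (≤-refl {lo})
  ... | inj₁ lo<lo = ⊥-elim (<-irrefl refl lo<lo)
  ... | inj₂ e rewrite ≡-irrelevant e refl = refl
  from-to (inj₂ (f , (lo<f , _) , x)) with m≤n⇒m<n∨m≡n (<⇒≤ lo<f)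
  ... | inj₁ _    = cong (λ r → inj₂ (f , r , x)) (InRange-irrelevant _ _)
  ... | inj₂ refl = ⊥-elim (<-irrefl refl lo<f)

applyUpTo-cong : {f g : ℕ → ℕ} → (∀ i → f i ≡ g i) → ∀ n → applyUpTo f n ≡ applyUpTo g n
applyUpTo-cong f≗g zero    = refl
applyUpTo-cong f≗g (suc n) = cong₂ _∷_ (f≗g 0) (applyUpTo-cong (λ i → f≗g (suc i)) n)

sum-range-↔ : (g : ℕ → ℕ) (lo n : ℕ) →
  Fin (sum (map g (applyUpTo (lo +_) n))) ↔ ΣInRange lo n (λ f → Fin (g f))
sum-range-↔ g lo zero = Fin0↔ λ (f , (lo≤f , f<lo+0) , _) →
  <-irrefl refl (<-≤-trans f<lo+0 (subst (_≤ f) (sym (+-identityʳ lo)) lo≤f))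
sum-range-↔ g lo (suc n) =
  Fin-cong (cong₂ _+_ (cong g (+-identityʳ lo))
                      (cong (λ xs → sum (map g xs)) (applyUpTo-cong (+-suc lo) n)))
  ⟫ +↔⊎ ⟫ (↔-refl ⊎-↔ sum-range-↔ g (suc lo) n) ⟫ Σ-InRange-suc (λ f → Fin (g f)) lo n

trues : {p : ℕ} → Vec Bool p → ℕ
trues []          = 0
trues (true ∷ v)  = suc (trues v)
trues (false ∷ v) = trues v

trues≤length : {p : ℕ} (v : Vec Bool p) → trues v ≤ p
trues≤length []          = z≤n
trues≤length (true ∷ v)  = s≤s (trues≤length v)
trues≤length (false ∷ v) = m≤n⇒m≤1+n (trues≤length v)

Subsets : ℕ → ℕ → Set
Subsets p f = Σ (Vec Bool p) (λ v → trues v ≡ f)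

Subsets-0 : {p : ℕ} → Subsets p 0 ↔ Subsets (suc p) 0
Subsets-0 {p} = mk↔ₛ′ to from to-from (λ _ → refl)
  where
  to : Subsets p 0 → Subsets (suc p) 0
  to (v , e) = false ∷ v , e
  from : Subsets (suc p) 0 → Subsets p 0
  from (false ∷ v , e) = v , e
  to-from : ∀ y → to (from y) ≡ y
  to-from (false ∷ v , e) = refl

Subsets-suc : {p f : ℕ} → (Subsets p f ⊎ Subsets p (suc f)) ↔ Subsets (suc p) (suc f)
Subsets-suc {p} {f} = mk↔ₛ′ to from to-from from-to
  where
  to : Subsets p f ⊎ Subsets p (suc f) → Subsets (suc p) (suc f)
  to (inj₁ (v , e)) = true ∷ v , cong suc e
  to (inj₂ (v , e)) = false ∷ v , e
  from : Subsets (suc p) (suc f) → Subsets p f ⊎ Subsets p (suc f)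
  from (true ∷ v , e)  = inj₁ (v , suc-injective e)
  from (false ∷ v , e) = inj₂ (v , e)
  to-from : ∀ y → to (from y) ≡ y
  to-from (true ∷ v , e)  = cong (true ∷ v ,_) (≡-irrelevant _ _)
  to-from (false ∷ v , e) = refl
  from-to : ∀ x → from (to x) ≡ x
  from-to (inj₁ (v , e)) = cong (λ e → inj₁ (v , e)) (≡-irrelevant _ _)
  from-to (inj₂ (v , e)) = refl

C↔Subsets : ∀ p f → Fin (p C f) ↔ Subsets p f
C↔Subsets zero    zero    = Fin1↔ ([] , refl) λ { ([] , refl) → refl }
C↔Subsets zero    (suc f) = Fin0↔ λ { ([] , ()) }
C↔Subsets (suc p) zero    = C↔Subsets p zero ⟫ Subsets-0
C↔Subsets (suc p) (suc f) =
  Fin-cong (sym (nCk+nC[k+1]≡[n+1]C[k+1] p f)) ⟫ +↔⊎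
  ⟫ (C↔Subsets p f ⊎-↔ C↔Subsets p (suc f)) ⟫ Subsets-suc

Solutions : ℕ → ℕ → Set
Solutions n N = Σ (Vec ℕ n) (λ d → Vec.sum d ≡ N)

Solutions-zero : (n : ℕ) (d : Vec ℕ n) → Vec.sum d ≡ 0 → d ≡ replicate n 0
Solutions-zero zero    []      _ = refl
Solutions-zero (suc n) (x ∷ d) e =
  cong₂ _∷_ (m+n≡0⇒m≡0 x e) (Solutions-zero n d (m+n≡0⇒n≡0 x e))

sum-replicate-0 : ∀ n → Vec.sum (replicate n 0) ≡ 0
sum-replicate-0 zero    = refl
sum-replicate-0 (suc n) = sum-replicate-0 n

Solutions-suc : {n N : ℕ} →
  (Solutions (suc n) (suc N) ⊎ Solutions (suc (suc n)) N) ↔ Solutions (suc (suc n)) (suc N)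
Solutions-suc {n} {N} = mk↔ₛ′ to from to-from from-to
  where
  to : Solutions (suc n) (suc N) ⊎ Solutions (suc (suc n)) N → Solutions (suc (suc n)) (suc N)
  to (inj₁ (d , e))     = 0 ∷ d , e
  to (inj₂ (x ∷ d , e)) = suc x ∷ d , cong suc e
  from : Solutions (suc (suc n)) (suc N) → Solutions (suc n) (suc N) ⊎ Solutions (suc (suc n)) N
  from (zero ∷ d , e)  = inj₁ (d , e)
  from (suc x ∷ d , e) = inj₂ (x ∷ d , suc-injective e)
  to-from : ∀ y → to (from y) ≡ y
  to-from (zero ∷ d , e)  = refl
  to-from (suc x ∷ d , e) = cong (suc x ∷ d ,_) (≡-irrelevant _ _)
  from-to : ∀ x → from (to x) ≡ x
  from-to (inj₁ (d , e))     = refl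
  from-to (inj₂ (x ∷ d , e)) = cong (λ e → inj₂ (x ∷ d , e)) (≡-irrelevant _ _)

stars-and-bars : ∀ n N → Fin ((N + n) C n) ↔ Solutions (suc n) N
stars-and-bars zero N = Fin1↔ (N ∷ [] , +-identityʳ N) λ { (x ∷ [] , e) →
  Σ-≡,≡→≡ (cong (_∷ []) (trans (sym (+-identityʳ x)) e) , ≡-irrelevant _ _) }
stars-and-bars (suc n) zero = Fin-cong (nCn≡1 (suc n))
  ⟫ Fin1↔ (replicate (suc (suc n)) 0 , sum-replicate-0 (suc (suc n))) λ (d , e) →
      Σ-≡,≡→≡ (Solutions-zero (suc (suc n)) d e , ≡-irrelevant _ _)
stars-and-bars (suc n) (suc N) =
  Fin-cong (trans (sym (nCk+nC[k+1]≡[n+1]C[k+1] (N + suc n) n))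
                  (cong (λ k → k C n + (N + suc n) C suc n) (+-suc N n)))
  ⟫ +↔⊎ ⟫ (stars-and-bars n (suc N) ⊎-↔ stars-and-bars (suc n) N) ⟫ Solutions-suc

split : {p : ℕ} → Vec ℕ p → Σ (Vec Bool p) (λ v → Vec ℕ (trues v))
split []          = [] , []
split (zero ∷ b)  = false ∷ proj₁ (split b) , proj₂ (split b)
split (suc x ∷ b) = true ∷ proj₁ (split b) , x ∷ proj₂ (split b)

merge : {p : ℕ} (v : Vec Bool p) → Vec ℕ (trues v) → Vec ℕ p
merge []          []      = []
merge (false ∷ v) d       = 0 ∷ merge v d
merge (true ∷ v)  (x ∷ d) = suc x ∷ merge v d

merge-split : {p : ℕ} (b : Vec ℕ p) → merge (proj₁ (split b)) (proj₂ (split b)) ≡ b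
merge-split []          = refl
merge-split (zero ∷ b)  = cong (0 ∷_) (merge-split b)
merge-split (suc x ∷ b) = cong (suc x ∷_) (merge-split b)

split-merge : {p : ℕ} (v : Vec Bool p) (d : Vec ℕ (trues v)) → split (merge v d) ≡ (v , d)
split-merge []          []      = refl
split-merge (false ∷ v) d       with split (merge v d) | split-merge v d
... | .(v , d) | refl = refl
split-merge (true ∷ v)  (x ∷ d) with split (merge v d) | split-merge v d
... | .(v , d) | refl = refl

support-↔ : {p : ℕ} → Vec ℕ p ↔ Σ (Vec Bool p) (λ v → Vec ℕ (trues v))
support-↔ = mk↔ₛ′ split (λ (v , d) → merge v d) (λ (v , d) → split-merge v d) merge-split

+-swap : ∀ x y z → x + (y + z) ≡ y + (x + z)
+-swap x y z = trans (sym (+-assoc x y z)) (trans (cong (_+ z) (+-comm x y)) (+-assoc y x z))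

∸-weight : ∀ {a x n} → a + x ≡ n → n ∸ a ≡ x
∸-weight {a} {x} e = trans (cong (_∸ a) (sym e)) (m+n∸m≡n a x)

sum-merge : {p : ℕ} (v : Vec Bool p) (d : Vec ℕ (trues v)) →
            Vec.sum (merge v d) ≡ trues v + Vec.sum d
sum-merge []          []      = refl
sum-merge (false ∷ v) d       = sum-merge v d
sum-merge (true ∷ v)  (x ∷ d) =
  cong suc (trans (cong (x +_) (sum-merge v d)) (+-swap x (trues v) (Vec.sum d)))

does-suc-≤?-suc : ∀ j x → does (suc j ≤? suc x) ≡ does (j ≤? x)
does-suc-≤?-suc zero    x = refl
does-suc-≤?-suc (suc j) x = refl

count-suc-≤?-merge : (j : ℕ) {p : ℕ} (v : Vec Bool p) (d : Vec ℕ (trues v)) →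
                      count (suc j ≤?_) (merge v d) ≡ count (j ≤?_) d
count-suc-≤?-merge j []          []      = refl
count-suc-≤?-merge j (false ∷ v) d       = count-suc-≤?-merge j v d
count-suc-≤?-merge j (true ∷ v)  (x ∷ d)
  rewrite does-suc-≤?-suc j x | count-suc-≤?-merge j v d = refl

count-0-≤? : {p : ℕ} (d : Vec ℕ p) → count (0 ≤?_) d ≡ p
count-0-≤? []      = refl
count-0-≤? (x ∷ d) = cong suc (count-0-≤? d)

count-suc-≤?-map-suc : (j : ℕ) {p : ℕ} (b : Vec ℕ p) →
                        count (suc j ≤?_) (Vec.map suc b) ≡ count (j ≤?_) b
count-suc-≤?-map-suc j []      = refl
count-suc-≤?-map-suc j (x ∷ b)
  rewrite does-suc-≤?-suc j x | count-suc-≤?-map-suc j b = refl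

sum-map-suc : {p : ℕ} (b : Vec ℕ p) → Vec.sum (Vec.map suc b) ≡ p + Vec.sum b
sum-map-suc []              = refl
sum-map-suc {suc p} (x ∷ b) =
  cong suc (trans (cong (x +_) (sum-map-suc b)) (+-swap x p (Vec.sum b)))

map-suc-pred : {p : ℕ} {a : Vec ℕ p} → All (1 ≤_) a → Vec.map suc (Vec.map pred a) ≡ a
map-suc-pred []                          = refl
map-suc-pred {a = suc x ∷ _} (s≤s _ ∷ pos) = cong (suc x ∷_) (map-suc-pred pos)

all-positive-map-suc : {p : ℕ} (b : Vec ℕ p) → All (1 ≤_) (Vec.map suc b)
all-positive-map-suc []      = []
all-positive-map-suc (x ∷ b) = s≤s z≤n ∷ all-positive-map-suc b

lower-↔ : {p : ℕ} (P : Vec ℕ p → Set) → (∀ {a} → Irrelevant (P a)) →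
          Σ (Vec ℕ p) (λ b → P (Vec.map suc b)) ↔ Σ (Vec ℕ p) (λ a → All (1 ≤_) a × P a)
lower-↔ P irrP = mk↔ₛ′
  (λ (b , x) → Vec.map suc b , all-positive-map-suc b , x)
  (λ (a , pos , x) → Vec.map pred a , subst P (sym (map-suc-pred pos)) x)
  (λ (a , pos , x) →
     Σ-≡,≡→≡ (map-suc-pred pos , ×-irrelevant (All.irrelevant ≤-irrelevant) irrP _ _))
  (λ (b , x) → Σ-≡,≡→≡ (trans (sym (map-∘ pred suc b)) (map-id b) , irrP _ _))

module _ (M L : ℕ) where

  -- b has weight M ∸ acc (stated without truncated subtraction) and exactly L
  -- entries ≥ j; along the chain, acc = f₁ + ⋯ + f_k.
  Fills : ℕ → ℕ → {p : ℕ} → Vec ℕ p → Set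
  Fills j acc b = acc + Vec.sum b ≡ M × count (j ≤?_) b ≡ L

  Fillings : ℕ → ℕ → ℕ → Set
  Fillings j acc p = Σ (Vec ℕ p) (Fills j acc)

  Fills-merge : (j acc : ℕ) {p : ℕ} (v : Vec Bool p) (d : Vec ℕ (trues v)) →
                Fills (suc j) acc (merge v d) ↔ Fills j (acc + trues v) d
  Fills-merge j acc v d = ≡⇒↔ (cong₂ (λ w n → w ≡ M × n ≡ L) weight (count-suc-≤?-merge j v d))
    where
    weight : acc + Vec.sum (merge v d) ≡ acc + trues v + Vec.sum d
    weight = trans (cong (acc +_) (sum-merge v d)) (sym (+-assoc acc (trues v) (Vec.sum d)))

  Fillings-split : ∀ j acc p →
    Fillings (suc j) acc p ↔ Σ ℕ (λ f → Subsets p f × Fillings j (acc + f) f)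
  Fillings-split j acc p =
    ↔-sym (Σ-↔ (↔-sym support-↔) (λ { {v , d} → ↔-sym (Fills-merge j acc v d) }))
    ⟫ Σ-assoc ⟫ Σ-fibres (λ f → Fillings j (acc + f) f) trues

  Tail : ℕ → Set
  Tail acc = Σ (Vec ℕ L) (λ d → acc + L + Vec.sum d ≡ M)

  Fillings-0 : ∀ acc p → Fillings 0 acc p ↔ (p ≡ L × Σ (Vec ℕ p) (λ d → acc + Vec.sum d ≡ M))
  Fillings-0 acc p = mk↔ₛ′
    (λ (d , weight , big) → trans (sym (count-0-≤? d)) big , d , weight)
    (λ (p≡L , d , weight) → d , weight , trans (count-0-≤? d) p≡L)
    (λ (p≡L , d , weight) → cong (λ e → e , d , weight) (≡-irrelevant _ _))
    (λ (d , weight , big) → cong (λ e → d , weight , e) (≡-irrelevant _ _))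

  Fillings-1 : ∀ acc p → Fillings 1 acc p ↔ (Subsets p L × Tail acc)
  Fillings-1 acc p = Fillings-split 0 acc p
    ⟫ Σ-↔ ↔-refl (↔-refl ×-↔ Fillings-0 (acc + _) _) ⟫ Σ-at L

  Fillings-1-count : (t : ℕ → ℕ) → (∀ acc → Fin (t acc) ↔ Tail acc) →
                     ∀ p acc → Fin ((p C L) * t acc) ↔ Fillings 1 acc p
  Fillings-1-count t tail p acc = *↔× ⟫ (C↔Subsets p L ×-↔ tail acc) ⟫ ↔-sym (Fillings-1 acc p)

  chain : (lo : ℕ) (fin : ℕ → ℕ → ℕ) → lo ≤ L →
          (∀ p acc → Fin (fin p acc) ↔ Fillings 1 acc p) →
          ∀ k p acc → Fin (chainSum lo fin k p acc) ↔ Fillings (suc k) acc p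
  chain lo fin lo≤L base zero    p acc = base p acc
  chain lo fin lo≤L base (suc k) p acc = begin
    Fin (chainSum lo fin (suc k) p acc)
      ↔⟨ sum-range-↔ g lo (suc p ∸ lo) ⟩
    ΣInRange lo (suc p ∸ lo) (λ f → Fin (g f))
      ↔⟨ Σ-↔ ↔-refl (↔-refl ×-↔ (*↔× ⟫ (C↔Subsets p _ ×-↔ chain lo fin lo≤L base k _ _))) ⟩
    ΣInRange lo (suc p ∸ lo) (λ f → Subsets p f × Fillings (suc k) (acc + f) f)
      ↔⟨ Σ-add-implied InRange-irrelevant in-range ⟨
    Σ ℕ (λ f → Subsets p f × Fillings (suc k) (acc + f) f)
      ↔⟨ Fillings-split (suc k) acc p ⟨
    Fillings (suc (suc k)) acc p ∎
    where
    open EquationalReasoning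
    g : ℕ → ℕ
    g f = (p C f) * chainSum lo fin k f (acc + f)
    in-range : ∀ f → Subsets p f × Fillings (suc k) (acc + f) f → InRange lo (suc p ∸ lo) f
    in-range f ((v , trues≡f) , d , _ , big≡L) =
      lo≤f , subst (f <_) (sym (m+[n∸m]≡n lo≤1+p)) (s≤s f≤p)
      where
      f≤p : f ≤ p
      f≤p = subst (_≤ p) trues≡f (trues≤length v)
      lo≤f : lo ≤ f
      lo≤f = ≤-trans lo≤L (subst (_≤ f) big≡L (count≤n (suc k ≤?_) d))
      lo≤1+p : lo ≤ suc p
      lo≤1+p = ≤-trans lo≤f (m≤n⇒m≤1+n f≤p)

δ-↔ : ∀ a b → Fin (δ a b) ↔ (a ≡ b)
δ-↔ a b with a ≟ b
... | yes refl = Fin1↔ refl λ e → ≡-irrelevant e refl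
... | no  a≢b  = Fin0↔ a≢b

Tail-0 : ∀ M acc → Fin (δ acc M) ↔ Tail M 0 acc
Tail-0 M acc = δ-↔ acc M ⟫ mk↔ₛ′
  (λ e → [] , trans acc+0+0≡acc e) (λ { ([] , e) → trans (sym acc+0+0≡acc) e })
  (λ { ([] , e) → cong ([] ,_) (≡-irrelevant _ _) }) (λ _ → ≡-irrelevant _ _)
  where
  acc+0+0≡acc : acc + 0 + 0 ≡ acc
  acc+0+0≡acc = trans (+-identityʳ (acc + 0)) (+-identityʳ acc)

Tail-suc : ∀ M l acc → Fin (tailFactor (suc l) (M ∸ acc)) ↔ Tail M (suc l) acc
Tail-suc M l acc with suc l ≤? M ∸ acc
... | yes l<R = Fin-cong (cong (_C l) R-1≡N+l) ⟫ stars-and-bars l N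
                ⟫ Σ-↔ ↔-refl (λ {d} → irrelevant-↔ ≡-irrelevant ≡-irrelevant (to d) (from d))
  where
  R = M ∸ acc
  N = R ∸ suc l
  R-1≡N+l : R ∸ 1 ≡ N + l
  R-1≡N+l = trans (cong (_∸ 1) (sym (m+[n∸m]≡n l<R))) (+-comm l N)
  acc≤M : acc ≤ M
  acc≤M = <⇒≤ (m∸n≢0⇒n<m λ R≡0 → n≮0 (subst (l <_) R≡0 l<R))
  weight : acc + suc l + N ≡ M
  weight = trans (+-assoc acc (suc l) N) (trans (cong (acc +_) (m+[n∸m]≡n l<R)) (m+[n∸m]≡n acc≤M))
  to : ∀ d → Vec.sum d ≡ N → acc + suc l + Vec.sum d ≡ M
  to d e = trans (cong (acc + suc l +_) e) weight
  from : ∀ d → acc + suc l + Vec.sum d ≡ M → Vec.sum d ≡ N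
  from d e = +-cancelˡ-≡ (acc + suc l) _ _ (trans e (sym weight))
... | no  l≮R = Fin0↔ λ (d , e) → l≮R (subst (suc l ≤_)
      (sym (∸-weight (trans (sym (+-assoc acc (suc l) (Vec.sum d))) e)))
      (m≤m+n (suc l) (Vec.sum d)))

Fillings↔Compositions : (s m h ℓ : ℕ) → h ≤ m →
  Fillings (m ∸ h) ℓ (suc s) 0 h ↔ Σ (Vec ℕ h) (λ a → IsComposition m h a × bigParts s a ≡ ℓ)
Fillings↔Compositions s m h ℓ h≤m =
  Σ-↔ ↔-refl (λ {b} → weight-↔ b ×-↔ ≡⇒↔ (cong (_≡ ℓ) (sym (count-suc-≤?-map-suc (suc s) b))))
  ⟫ lower-↔ P (×-irrelevant ≡-irrelevant ≡-irrelevant) ⟫ Σ-↔ ↔-refl (↔-sym Σ-assoc)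
  where
  P : Vec ℕ h → Set
  P a = Vec.sum a ≡ m × bigParts s a ≡ ℓ
  weight-↔ : (b : Vec ℕ h) → (Vec.sum b ≡ m ∸ h) ↔ (Vec.sum (Vec.map suc b) ≡ m)
  weight-↔ b = irrelevant-↔ ≡-irrelevant ≡-irrelevant
    (λ e → trans (sum-map-suc b) (trans (cong (h +_) e) (m+[n∸m]≡n h≤m)))
    (λ e → sym (∸-weight (trans (sym (sum-map-suc b)) e)))

lemmaI : (s m h ℓ : ℕ) → 1 ≤ h → h ≤ m →
    Fin (c s m h ℓ) ↔ Σ (Vec ℕ h) (λ a → IsComposition m h a × bigParts s a ≡ ℓ)
lemmaI s m h zero _ h≤m =
  -- (p C 0) * δ acc M computes to 1 * δ acc M.
  chain (m ∸ h) 0 0 (λ _ acc → δ acc (m ∸ h)) z≤n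
    (λ p acc → Fin-cong (sym (*-identityˡ _)) ⟫ Fillings-1-count (m ∸ h) 0 _ (Tail-0 (m ∸ h)) p acc)
    s h 0
  ⟫ Fillings↔Compositions s m h 0 h≤m
lemmaI s m h (suc l) _ h≤m =
  chain (m ∸ h) (suc l) (suc l)
    (λ last acc → (last C suc l) * tailFactor (suc l) (m ∸ h ∸ acc)) ≤-refl
    (Fillings-1-count (m ∸ h) (suc l) _ (Tail-suc (m ∸ h) l))
    s h 0
  ⟫ Fillings↔Compositions s m h (suc l) h≤m
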